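{- For $n\ge1$ let $C_n(y)=\sum_{k=0}^{n-1}y^{\,n-k-1}T(n-1,k)$, where $T(m,k)=\frac{(m+k)!}{(m-k)!\,k!}$. Then $C_1(y)=1$ and for all $n\ge2$, $$C_n(y)=(4n-6+y)\,C_{n-1}(y)-2y\,\frac{d}{dy}C_{n-1}(y).$$ -}

module Defs where

open import Data.Nat using (ℕ; zero; suc; _+_; _∸_; _!; _/_)
open import Data.Nat.Properties using (_!*_!≢0)
open import Data.Integer as ℤ using (ℤ; +_)
open import Data.List using (List; []; _∷_; map; replicate; _++_; foldr; upTo)
open import Relation.Binary.PropositionalEquality using (_≡_)

-- T(m,k) = (m+k)! / ((m-k)! k!)   (exact division for k ≤ m)
T : ℕ → ℕ → ℕ
T m k = ((m + k) !) / ((m ∸ k) ! * k !)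
  where
  open Data.Nat using (_*_)
  instance _ = (m ∸ k) !* k !≢0

-- Polynomials in y with integer coefficients, as coefficient lists
-- (lowest degree first). Equality is coefficientwise (trailing zeros ignored).
Poly : Set
Poly = List ℤ

infixl 6 _+ᴾ_
_+ᴾ_ : Poly → Poly → Poly
[] +ᴾ q = q
(a ∷ p) +ᴾ [] = a ∷ p
(a ∷ p) +ᴾ (b ∷ q) = (a ℤ.+ b) ∷ (p +ᴾ q)

_·ᴾ_ : ℤ → Poly → Poly
c ·ᴾ p = map (c ℤ.*_) p

Y* : Poly → Poly
Y* p = + 0 ∷ p

mono : ℕ → ℤ → Poly
mono d c = replicate d (+ 0) ++ (c ∷ [])

sumᴾ : List Poly → Poly
sumᴾ = foldr _+ᴾ_ []

derivFrom : ℕ → Poly → Poly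
derivFrom i [] = []
derivFrom i (a ∷ p) = (+ i ℤ.* a) ∷ derivFrom (suc i) p

deriv : Poly → Poly
deriv [] = []
deriv (a ∷ p) = derivFrom 1 p

coeff : Poly → ℕ → ℤ
coeff [] j = + 0
coeff (a ∷ p) zero = a
coeff (a ∷ p) (suc j) = coeff p j

infix 4 _≈ᴾ_
_≈ᴾ_ : Poly → Poly → Set
p ≈ᴾ q = ∀ j → coeff p j ≡ coeff q j

C : ℕ → Poly
C n = sumᴾ (map (λ k → mono (n ∸ k ∸ 1) (+ T (n ∸ 1) k)) (upTo n))

-- In C_{m+1} the coefficient of y^j is T(m, m-j).  Writing k = m - j and comparing
-- coefficients of y^j, the recurrence says T(m+1,k+1) = 2(m+k+1) T(m,k) + T(m,k+1)
-- (without the last term when j = 0), and T(m+1,0) = T(m,0) = 1 in degree m+1.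
-- Multiplied by (m-k)! (k+1)! the first identity becomes
-- (m+k+2)! = 2(m+k+1)(k+1) (m+k)! + (m-k) (m+k+1)!, true because 2(k+1) + (m-k) = m+k+2.
module Submission where

open import Defs
open import Data.Nat using (ℕ; zero; suc; _≤_; _<_; _∸_; _*_; _+_; _!; s≤s; _≟_)
open import Data.Nat.Properties
  using (+-suc; +-comm; +-identityʳ; *-identityˡ; *-identityʳ; *-cancelʳ-≡; m*n≢0; _!≢0; _!*_!≢0;
         m+n∸n≡m; m+n∸m≡n; +-∸-assoc; n∸n≡0; m≤m+n; m≤n+m; n≤1+n; ≤-refl; ≤-trans; ≤-pred;
         <-irrefl; <-cmp; ≤∧≢⇒<; m≤n⇒∃[o]m+o≡n)
open import Data.Nat.Divisibility using (∣-trans; m≤n⇒m!∣n!)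
open import Data.Nat.DivMod using (m/n*n≡m)
open import Data.Nat.Combinatorics using ([n∸k]!k!∣n!)
import Data.Nat.Tactic.RingSolver as ℕ-Solver
open import Data.Integer as ℤ using (ℤ; +_; -_; _-_; _⊖_)
import Data.Integer.Properties as ℤP
import Data.Integer.Tactic.RingSolver as ℤ-Solver
open import Data.List using ([]; _∷_; applyUpTo)
open import Data.List.Properties using (map-applyUpTo)
open import Data.Product using (_×_; _,_)
open import Function using (_∘_; id)
open import Relation.Binary.Definitions using (tri<; tri≈; tri>)
open import Relation.Binary.PropositionalEquality
open import Relation.Nullary using (Dec; yes; no; contradiction)

open ≡-Reasoning

coeff-+ᴾ : ∀ p q j → coeff (p +ᴾ q) j ≡ coeff p j ℤ.+ coeff q j
coeff-+ᴾ []      q       j       = sym (ℤP.+-identityˡ _)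
coeff-+ᴾ (a ∷ p) []      j       = sym (ℤP.+-identityʳ _)
coeff-+ᴾ (a ∷ p) (b ∷ q) zero    = refl
coeff-+ᴾ (a ∷ p) (b ∷ q) (suc j) = coeff-+ᴾ p q j

coeff-·ᴾ : ∀ c p j → coeff (c ·ᴾ p) j ≡ c ℤ.* coeff p j
coeff-·ᴾ c []      j       = sym (ℤP.*-zeroʳ c)
coeff-·ᴾ c (a ∷ p) zero    = refl
coeff-·ᴾ c (a ∷ p) (suc j) = coeff-·ᴾ c p j

coeff-derivFrom : ∀ i p j → coeff (derivFrom i p) j ≡ + (i + j) ℤ.* coeff p j
coeff-derivFrom i []      j       = sym (ℤP.*-zeroʳ (+ (i + j)))
coeff-derivFrom i (a ∷ p) zero    = cong (λ t → + t ℤ.* a) (sym (+-identityʳ i))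
coeff-derivFrom i (a ∷ p) (suc j) = begin
  coeff (derivFrom (suc i) p) j  ≡⟨ coeff-derivFrom (suc i) p j ⟩
  + (suc i + j) ℤ.* coeff p j    ≡⟨ cong (λ t → + t ℤ.* coeff p j) (sym (+-suc i j)) ⟩
  + (i + suc j) ℤ.* coeff p j    ∎

coeff-Y*-deriv : ∀ p j → coeff (Y* (deriv p)) j ≡ + j ℤ.* coeff p j
coeff-Y*-deriv p       zero    = sym (ℤP.*-zeroˡ (coeff p 0))
coeff-Y*-deriv []      (suc j) = sym (ℤP.*-zeroʳ (+ suc j))
coeff-Y*-deriv (a ∷ p) (suc j) = coeff-derivFrom 1 p j

coeff-mono-≡ : ∀ d c → coeff (mono d c) d ≡ c
coeff-mono-≡ zero    c = refl
coeff-mono-≡ (suc d) c = coeff-mono-≡ d c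

coeff-mono-≢ : ∀ d c j → j ≢ d → coeff (mono d c) j ≡ + 0
coeff-mono-≢ zero    c zero    j≢d = contradiction refl j≢d
coeff-mono-≢ zero    c (suc j) j≢d = refl
coeff-mono-≢ (suc d) c zero    j≢d = refl
coeff-mono-≢ (suc d) c (suc j) j≢d = coeff-mono-≢ d c j (j≢d ∘ cong suc)

fromReversedCoeffs : (ℕ → ℤ) → ℕ → Poly
fromReversedCoeffs g n = sumᴾ (applyUpTo (λ k → mono (n ∸ k ∸ 1) (g k)) n)

coeff-fromReversedCoeffs-≥ : ∀ g n j → n ≤ j → coeff (fromReversedCoeffs g n) j ≡ + 0
coeff-fromReversedCoeffs-≥ g zero    j n≤j = refl
coeff-fromReversedCoeffs-≥ g (suc n) j n<j = begin
  coeff (mono n (g 0) +ᴾ fromReversedCoeffs (g ∘ suc) n) j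
    ≡⟨ coeff-+ᴾ (mono n (g 0)) _ j ⟩
  coeff (mono n (g 0)) j ℤ.+ coeff (fromReversedCoeffs (g ∘ suc) n) j
    ≡⟨ cong₂ ℤ._+_ (coeff-mono-≢ n (g 0) j (λ { refl → <-irrefl refl n<j }))
                   (coeff-fromReversedCoeffs-≥ (g ∘ suc) n j (≤-trans (n≤1+n n) n<j)) ⟩
  + 0 ∎

coeff-fromReversedCoeffs-< : ∀ g n j → j < n → coeff (fromReversedCoeffs g n) j ≡ g (n ∸ suc j)
coeff-fromReversedCoeffs-< g (suc n) j j<1+n = begin
  coeff (mono n (g 0) +ᴾ fromReversedCoeffs (g ∘ suc) n) j
    ≡⟨ coeff-+ᴾ (mono n (g 0)) _ j ⟩
  coeff (mono n (g 0)) j ℤ.+ coeff (fromReversedCoeffs (g ∘ suc) n) j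
    ≡⟨ split (j ≟ n) ⟩
  g (n ∸ j) ∎
  where
  split : Dec (j ≡ n) → coeff (mono n (g 0)) j ℤ.+ coeff (fromReversedCoeffs (g ∘ suc) n) j ≡ g (n ∸ j)
  split (yes refl) = begin
    coeff (mono j (g 0)) j ℤ.+ coeff (fromReversedCoeffs (g ∘ suc) j) j
      ≡⟨ cong₂ ℤ._+_ (coeff-mono-≡ j (g 0)) (coeff-fromReversedCoeffs-≥ (g ∘ suc) j j ≤-refl) ⟩
    g 0 ℤ.+ + 0  ≡⟨ ℤP.+-identityʳ (g 0) ⟩
    g 0          ≡⟨ cong g (sym (n∸n≡0 j)) ⟩
    g (j ∸ j)    ∎
  split (no j≢n) = begin
    coeff (mono n (g 0)) j ℤ.+ coeff (fromReversedCoeffs (g ∘ suc) n) j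
      ≡⟨ cong₂ ℤ._+_ (coeff-mono-≢ n (g 0) j j≢n) (coeff-fromReversedCoeffs-< (g ∘ suc) n j j<n) ⟩
    + 0 ℤ.+ g (suc (n ∸ suc j))  ≡⟨ ℤP.+-identityˡ _ ⟩
    g (suc (n ∸ suc j))          ≡⟨ cong g (sym (+-∸-assoc 1 j<n)) ⟩
    g (n ∸ j)                    ∎
    where j<n = ≤∧≢⇒< (≤-pred j<1+n) j≢n

C≡fromReversedCoeffs : ∀ n → C n ≡ fromReversedCoeffs (λ k → + T (n ∸ 1) k) n
C≡fromReversedCoeffs n = cong sumᴾ (map-applyUpTo id (λ k → mono (n ∸ k ∸ 1) (+ T (n ∸ 1) k)) n)

coeff-C : ∀ {j k m} → j + k ≡ m → coeff (C (suc m)) j ≡ + T m k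
coeff-C {j} {k} refl = begin
  coeff (C (suc (j + k))) j
    ≡⟨ cong (λ p → coeff p j) (C≡fromReversedCoeffs (suc (j + k))) ⟩
  coeff (fromReversedCoeffs (λ i → + T (j + k) i) (suc (j + k))) j
    ≡⟨ coeff-fromReversedCoeffs-< (λ i → + T (j + k) i) (suc (j + k)) j (s≤s (m≤m+n j k)) ⟩
  + T (j + k) (j + k ∸ j)
    ≡⟨ cong (+_ ∘ T (j + k)) (m+n∸m≡n j k) ⟩
  + T (j + k) k ∎

coeff-C-above-degree : ∀ {m j} → m < j → coeff (C (suc m)) j ≡ + 0
coeff-C-above-degree {m} {j} m<j = begin
  coeff (C (suc m)) j
    ≡⟨ cong (λ p → coeff p j) (C≡fromReversedCoeffs (suc m)) ⟩
  coeff (fromReversedCoeffs (λ i → + T m i) (suc m)) j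
    ≡⟨ coeff-fromReversedCoeffs-≥ (λ i → + T m i) (suc m) j m<j ⟩
  + 0 ∎

T-factorial : ∀ {r k m} → r + k ≡ m → T m k * (r ! * k !) ≡ (m + k) !
T-factorial {r} {k} refl = begin
  T (r + k) k * (r ! * k !)
    ≡⟨ cong (λ d → T (r + k) k * (d ! * k !)) (sym (m+n∸n≡m r k)) ⟩
  T (r + k) k * ((r + k ∸ k) ! * k !)
    ≡⟨ m/n*n≡m {{(r + k ∸ k) !* k !≢0}}
               (∣-trans ([n∸k]!k!∣n! (m≤n+m k r)) (m≤n⇒m!∣n! (m≤m+n (r + k) k))) ⟩
  (r + k + k) ! ∎

T-zero : ∀ m → T m 0 ≡ 1
T-zero m = *-cancelʳ-≡ (T m 0) 1 (m ! * 1) {{m*n≢0 (m !) 1 {{m !≢0}}}} (begin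
  T m 0 * (m ! * 1)  ≡⟨ T-factorial (+-identityʳ m) ⟩
  (m + 0) !          ≡⟨ cong _! (+-identityʳ m) ⟩
  m !                ≡⟨ *-identityʳ (m !) ⟨
  m ! * 1            ≡⟨ *-identityˡ (m ! * 1) ⟨
  1 * (m ! * 1)      ∎)

-- Not an instance of T-step: with truncated subtraction, T m (suc m) is not 0.
T-diag : ∀ m → T (suc m) (suc m) ≡ 2 * (m + suc m) * T m m
T-diag m = *-cancelʳ-≡ _ _ (0 ! * suc m !) {{0 !* suc m !≢0}} (begin
  T (suc m) (suc m) * (0 ! * suc m !)
    ≡⟨ T-factorial {0} {suc m} refl ⟩
  (suc m + suc m) !
    ≡⟨ cong (_! ∘ suc) (+-suc m m) ⟩
  (2 + (m + m)) * ((1 + (m + m)) * (m + m) !)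
    ≡⟨ cong (λ f → (2 + (m + m)) * ((1 + (m + m)) * f)) (sym (T-factorial {0} {m} refl)) ⟩
  (2 + (m + m)) * ((1 + (m + m)) * (T m m * (0 ! * m !)))
    ≡⟨ regroup m (T m m) (m !) ⟩
  2 * (m + suc m) * T m m * (0 ! * suc m !) ∎)
  where
  regroup : ∀ m t M → (2 + (m + m)) * ((1 + (m + m)) * (t * (1 * M)))
                     ≡ 2 * (m + suc m) * t * (1 * (suc m * M))
  regroup = ℕ-Solver.solve-∀

T-step : ∀ {m k} → k < m → T (suc m) (suc k) ≡ 2 * (m + suc k) * T m k + T m (suc k)
T-step {m} {k} k<m with m≤n⇒∃[o]m+o≡n k<m
... | r , refl = *-cancelʳ-≡ _ _ (suc r ! * suc k !) {{suc r !* suc k !≢0}} (begin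
  T (suc m) (suc k) * (suc r ! * suc k !)
    ≡⟨ T-factorial {suc r} (cong suc (+-comm r (suc k))) ⟩
  (suc m + suc k) !
    ≡⟨ cong (_! ∘ suc) (+-suc m k) ⟩
  (2 + (m + k)) * ((1 + (m + k)) * (m + k) !)
    ≡⟨ pascal k r ((m + k) !) ⟩
  2 * (m + suc k) * suc k * (m + k) ! + suc r * (1 + (m + k)) !
    ≡⟨ cong₂ (λ f g → 2 * (m + suc k) * suc k * f + suc r * g)
             (sym (T-factorial {suc r} {k} (cong suc (+-comm r k))))
             (sym (trans (T-factorial {r} {suc k} (+-comm r (suc k))) (cong _! (+-suc m k)))) ⟩
  2 * (m + suc k) * suc k * (T m k * (suc r ! * k !)) + suc r * (T m (suc k) * (r ! * suc k !))
    ≡⟨ regroup (2 * (m + suc k)) (T m k) (T m (suc k)) r (r !) k (k !) ⟩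
  (2 * (m + suc k) * T m k + T m (suc k)) * (suc r ! * suc k !) ∎)
  where
  pascal : ∀ k r F → (2 + (suc (k + r) + k)) * ((1 + (suc (k + r) + k)) * F)
                   ≡ 2 * (suc (k + r) + suc k) * suc k * F + suc r * ((1 + (suc (k + r) + k)) * F)
  pascal = ℕ-Solver.solve-∀
  regroup : ∀ a x y r R k K → a * suc k * (x * (suc r * R * K)) + suc r * (y * (R * (suc k * K)))
                            ≡ (a * x + y) * (suc r * R * (suc k * K))
  regroup = ℕ-Solver.solve-∀

recurrenceOp : ℤ → Poly → Poly
recurrenceOp a p = ((a ·ᴾ p) +ᴾ Y* p) +ᴾ ((- (+ 2)) ·ᴾ Y* (deriv p))

coeff-recurrenceOp : ∀ a p j → coeff (recurrenceOp a p) j ≡ (a - + (2 * j)) ℤ.* coeff p j ℤ.+ coeff (Y* p) j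
coeff-recurrenceOp a p j = begin
  coeff (recurrenceOp a p) j
    ≡⟨ coeff-+ᴾ ((a ·ᴾ p) +ᴾ Y* p) _ j ⟩
  coeff ((a ·ᴾ p) +ᴾ Y* p) j ℤ.+ coeff ((- (+ 2)) ·ᴾ Y* (deriv p)) j
    ≡⟨ cong₂ ℤ._+_ (trans (coeff-+ᴾ (a ·ᴾ p) (Y* p) j) (cong (ℤ._+ coeff (Y* p) j) (coeff-·ᴾ a p j)))
                   (trans (coeff-·ᴾ (- (+ 2)) (Y* (deriv p)) j) (cong ((- (+ 2)) ℤ.*_) (coeff-Y*-deriv p j))) ⟩
  (a ℤ.* coeff p j ℤ.+ coeff (Y* p) j) ℤ.+ (- (+ 2)) ℤ.* (+ j ℤ.* coeff p j)
    ≡⟨ collect a (coeff p j) (coeff (Y* p) j) (+ j) ⟩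
  (a - + 2 ℤ.* + j) ℤ.* coeff p j ℤ.+ coeff (Y* p) j
    ≡⟨ cong (λ t → (a - t) ℤ.* coeff p j ℤ.+ coeff (Y* p) j) (sym (ℤP.pos-* 2 j)) ⟩
  (a - + (2 * j)) ℤ.* coeff p j ℤ.+ coeff (Y* p) j ∎
  where
  collect : ∀ a x w J → (a ℤ.* x ℤ.+ w) ℤ.+ (- (+ 2)) ℤ.* (J ℤ.* x) ≡ (a - + 2 ℤ.* J) ℤ.* x ℤ.+ w
  collect = ℤ-Solver.solve-∀

+[m+n]-+n≡+m : ∀ m n → + (m + n) - + n ≡ + m
+[m+n]-+n≡+m m n = begin
  + (m + n) - + n  ≡⟨ ℤP.m-n≡m⊖n (m + n) n ⟩
  (m + n) ⊖ n      ≡⟨ ℤP.⊖-≥ (m≤n+m n m) ⟩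
  + (m + n ∸ n)    ≡⟨ cong +_ (m+n∸n≡m m n) ⟩
  + m              ∎

4n-6-2j≡2[m+k+1] : ∀ j k → + (4 * (2 + (j + k))) - + 6 - + (2 * j) ≡ + (2 * (j + k + suc k))
4n-6-2j≡2[m+k+1] j k = begin
  + (4 * (2 + (j + k))) - + 6 - + (2 * j)
    ≡⟨ cong (λ t → + t - + 6 - + (2 * j)) (split j k) ⟩
  + (2 * (j + k + suc k) + 2 * j + 6) - + 6 - + (2 * j)
    ≡⟨ cong (_- + (2 * j)) (+[m+n]-+n≡+m (2 * (j + k + suc k) + 2 * j) 6) ⟩
  + (2 * (j + k + suc k) + 2 * j) - + (2 * j)
    ≡⟨ +[m+n]-+n≡+m (2 * (j + k + suc k)) (2 * j) ⟩
  + (2 * (j + k + suc k)) ∎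
  where
  split : ∀ j k → 4 * (2 + (j + k)) ≡ 2 * (j + k + suc k) + 2 * j + 6
  split = ℕ-Solver.solve-∀

coeff-recurrenceOp-C : ∀ j k →
  coeff (recurrenceOp (+ (4 * (2 + (j + k))) - + 6) (C (suc (j + k)))) j
    ≡ + (2 * (j + k + suc k)) ℤ.* + T (j + k) k ℤ.+ coeff (Y* (C (suc (j + k)))) j
coeff-recurrenceOp-C j k =
  trans (coeff-recurrenceOp (+ (4 * (2 + (j + k))) - + 6) (C (suc (j + k))) j)
        (cong₂ (λ a x → a ℤ.* x ℤ.+ coeff (Y* (C (suc (j + k)))) j)
               (4n-6-2j≡2[m+k+1] j k) (coeff-C {j} {k} refl))

C-recurrence-≤ : ∀ j k →
  coeff (C (2 + (j + k))) j ≡ coeff (recurrenceOp (+ (4 * (2 + (j + k))) - + 6) (C (suc (j + k)))) j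
C-recurrence-≤ zero k = begin
  coeff (C (2 + k)) 0                          ≡⟨ coeff-C {0} {suc k} refl ⟩
  + T (suc k) (suc k)                          ≡⟨ cong +_ (T-diag k) ⟩
  + (2 * (k + suc k) * T k k)                  ≡⟨ ℤP.pos-* (2 * (k + suc k)) (T k k) ⟩
  + (2 * (k + suc k)) ℤ.* + T k k              ≡⟨ ℤP.+-identityʳ _ ⟨
  + (2 * (k + suc k)) ℤ.* + T k k ℤ.+ + 0      ≡⟨ coeff-recurrenceOp-C 0 k ⟨
  coeff (recurrenceOp (+ (4 * (2 + k)) - + 6) (C (suc k))) 0 ∎
C-recurrence-≤ (suc i) k = begin
  coeff (C (2 + m)) (suc i)
    ≡⟨ coeff-C {suc i} {suc k} (cong suc (+-suc i k)) ⟩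
  + T (suc m) (suc k)
    ≡⟨ cong +_ (T-step (s≤s (m≤n+m k i))) ⟩
  + (2 * (m + suc k) * T m k + T m (suc k))
    ≡⟨ trans (ℤP.pos-+ (2 * (m + suc k) * T m k) (T m (suc k)))
             (cong (ℤ._+ + T m (suc k)) (ℤP.pos-* (2 * (m + suc k)) (T m k))) ⟩
  + (2 * (m + suc k)) ℤ.* + T m k ℤ.+ + T m (suc k)
    ≡⟨ cong (ℤ._+_ (+ (2 * (m + suc k)) ℤ.* + T m k)) (coeff-C {i} {suc k} (+-suc i k)) ⟨
  + (2 * (m + suc k)) ℤ.* + T m k ℤ.+ coeff (C (suc m)) i
    ≡⟨ coeff-recurrenceOp-C (suc i) k ⟨
  coeff (recurrenceOp (+ (4 * (2 + m)) - + 6) (C (suc m))) (suc i) ∎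
  where m = suc (i + k)

C-recurrence-top : ∀ m →
  coeff (C (2 + m)) (suc m) ≡ coeff (recurrenceOp (+ (4 * (2 + m)) - + 6) (C (suc m))) (suc m)
C-recurrence-top m = begin
  coeff (C (2 + m)) (suc m)
    ≡⟨ coeff-C (+-identityʳ (suc m)) ⟩
  + T (suc m) 0
    ≡⟨ cong +_ (trans (T-zero (suc m)) (sym (T-zero m))) ⟩
  + T m 0
    ≡⟨ coeff-C (+-identityʳ m) ⟨
  coeff (C (suc m)) m
    ≡⟨ ℤP.+-identityˡ (coeff (C (suc m)) m) ⟨
  + 0 ℤ.+ coeff (C (suc m)) m
    ≡⟨ cong (ℤ._+ coeff (C (suc m)) m) (ℤP.*-zeroʳ a) ⟨
  a ℤ.* + 0 ℤ.+ coeff (C (suc m)) m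
    ≡⟨ cong (λ x → a ℤ.* x ℤ.+ coeff (C (suc m)) m) (coeff-C-above-degree {m} ≤-refl) ⟨
  a ℤ.* coeff (C (suc m)) (suc m) ℤ.+ coeff (C (suc m)) m
    ≡⟨ coeff-recurrenceOp (+ (4 * (2 + m)) - + 6) (C (suc m)) (suc m) ⟨
  coeff (recurrenceOp (+ (4 * (2 + m)) - + 6) (C (suc m))) (suc m) ∎
  where a = + (4 * (2 + m)) - + 6 - + (2 * suc m)

C-recurrence-above : ∀ m {j} → suc m < j →
  coeff (C (2 + m)) j ≡ coeff (recurrenceOp (+ (4 * (2 + m)) - + 6) (C (suc m))) j
C-recurrence-above m {suc i} (s≤s m<i) = begin
  coeff (C (2 + m)) (suc i)
    ≡⟨ coeff-C-above-degree (s≤s m<i) ⟩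
  + 0
    ≡⟨ trans (ℤP.+-identityʳ (a ℤ.* + 0)) (ℤP.*-zeroʳ a) ⟨
  a ℤ.* + 0 ℤ.+ + 0
    ≡⟨ cong₂ (λ x y → a ℤ.* x ℤ.+ y) (coeff-C-above-degree (≤-trans (n≤1+n (suc m)) (s≤s m<i)))
                                    (coeff-C-above-degree m<i) ⟨
  a ℤ.* coeff (C (suc m)) (suc i) ℤ.+ coeff (C (suc m)) i
    ≡⟨ coeff-recurrenceOp (+ (4 * (2 + m)) - + 6) (C (suc m)) (suc i) ⟨
  coeff (recurrenceOp (+ (4 * (2 + m)) - + 6) (C (suc m))) (suc i) ∎
  where a = + (4 * (2 + m)) - + 6 - + (2 * suc i)

C-recurrence : ∀ m → C (2 + m) ≈ᴾ recurrenceOp (+ (4 * (2 + m)) - + 6) (C (suc m))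
C-recurrence m j with <-cmp j (suc m)
... | tri< j≤m _ _ with m≤n⇒∃[o]m+o≡n (≤-pred j≤m)
...   | k , refl = C-recurrence-≤ j k
C-recurrence m j | tri≈ _ refl _ = C-recurrence-top m
C-recurrence m j | tri> _ _ 1+m<j = C-recurrence-above m 1+m<j

lemma8p16 : (C 1 ≈ᴾ (+ 1 ∷ []))
    × (∀ (n : ℕ) → 2 ≤ n →
         C n ≈ᴾ (((+ (4 * n) - + 6) ·ᴾ C (n ∸ 1)) +ᴾ Y* (C (n ∸ 1)))
                +ᴾ ((- (+ 2)) ·ᴾ Y* (deriv (C (n ∸ 1)))))
lemma8p16 = (λ { zero → refl ; (suc j) → refl }) , λ { (suc (suc m)) (s≤s (s≤s _)) → C-recurrence m }
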